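{- Let $\Gamma$ be a vertex-transitive CIS graph. Then $\Gamma$ is localizable if and only if $\alpha(\Gamma_{\mathcal{Q}})=\alpha(\Gamma)$.
   Context: All graphs are finite and simple. A clique is strong if it intersects every inclusion-maximal independent set. A graph is CIS if every inclusion-maximal clique is strong, and localizable if its vertex set can be partitioned into strong cliques. $\alpha$ denotes the independence number (size of a largest independent set). For a graph $\Gamma$, $\Gamma_{\mathcal{Q}}$ denotes the graph whose vertices are the inclusion-maximal cliques of $\Gamma$, two of them being adjacent iff they have non-empty intersection. A graph is vertex-transitive if its automorphism group acts transitively on its vertices. -}

module Defs where

open import Data.Nat using (ℕ; _≤_)
open import Data.Bool using (Bool; true; false; if_then_else_)
open import Data.Fin using (Fin; _≟_)
open import Data.Fin.Subset using (Subset; _∈_; _⊆_; _∩_; ∣_∣; Empty; inside; outside)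
open import Data.Vec using (tabulate)
open import Data.List using (List; length)
open import Data.List.Relation.Unary.All using (All)
open import Data.List.Relation.Unary.AllPairs using (AllPairs)
open import Data.List.Relation.Unary.Unique.Propositional using (Unique)
open import Data.Product using (Σ; ∃; _×_)
open import Function.Bundles using (_↔_; Inverse)
open import Relation.Nullary using (¬_; Dec; yes; no)
open import Relation.Binary.PropositionalEquality using (_≡_; _≢_)

record Graph (n : ℕ) : Set where
  field
    adj    : Fin n → Fin n → Bool
    symm   : ∀ u v → adj u v ≡ adj v u
    irrefl : ∀ v → adj v v ≡ false

module _ {n : ℕ} (G : Graph n) where
  open Graph G

  Adj : Fin n → Fin n → Set
  Adj u v = adj u v ≡ true

  IsClique : Subset n → Set
  IsClique C = ∀ {u v} → u ∈ C → v ∈ C → u ≢ v → Adj u v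

  IsIndependent : Subset n → Set
  IsIndependent I = ∀ {u v} → u ∈ I → v ∈ I → u ≢ v → ¬ Adj u v

  IsMaximalClique : Subset n → Set
  IsMaximalClique C = IsClique C × (∀ D → IsClique D → C ⊆ D → D ⊆ C)

  IsMaximalIndependent : Subset n → Set
  IsMaximalIndependent I =
    IsIndependent I × (∀ J → IsIndependent J → I ⊆ J → J ⊆ I)

  IsStrongClique : Subset n → Set
  IsStrongClique C =
    IsClique C × (∀ I → IsMaximalIndependent I → ∃ λ v → v ∈ C × v ∈ I)

  IsCIS : Set
  IsCIS = ∀ C → IsMaximalClique C → IsStrongClique C

  fiber : {k : ℕ} → (Fin n → Fin k) → Fin k → Subset n
  fiber f i = tabulate λ v → if Relation.Nullary.Decidable.⌊ f v ≟ i ⌋ then inside else outside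
    where import Relation.Nullary.Decidable

  -- vertex set partitioned into strong cliques: a map assigning each vertex
  -- its part, every part being a strong clique (strong cliques are nonempty,
  -- so every part is nonempty)
  IsLocalizable : Set
  IsLocalizable = Σ ℕ λ k → Σ (Fin n → Fin k) λ f → ∀ i → IsStrongClique (fiber f i)

  IsIndependenceNumber : ℕ → Set
  IsIndependenceNumber k =
    (∃ λ I → IsIndependent I × ∣ I ∣ ≡ k) × (∀ I → IsIndependent I → ∣ I ∣ ≤ k)

  -- independent sets of Γ_Q: finite sets (duplicate-free lists) of maximal
  -- cliques of Γ, any two distinct of which have empty intersection
  IsIndependentQ : List (Subset n) → Set
  IsIndependentQ L =
    Unique L × All IsMaximalClique L × AllPairs (λ C D → Empty (C ∩ D)) L

  IsIndependenceNumberQ : ℕ → Set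
  IsIndependenceNumberQ k =
    (∃ λ L → IsIndependentQ L × length L ≡ k)
    × (∀ L → IsIndependentQ L → length L ≤ k)

  IsAutomorphism : Fin n ↔ Fin n → Set
  IsAutomorphism σ = ∀ u v → adj u v ≡ adj (Inverse.to σ u) (Inverse.to σ v)

  IsVertexTransitive : Set
  IsVertexTransitive =
    ∀ u v → Σ (Fin n ↔ Fin n) λ σ → IsAutomorphism σ × Inverse.to σ u ≡ v

-- Fix a maximal independent set I. In a CIS graph every maximal clique meets I, so
-- pairwise disjoint maximal cliques number at most ∣ I ∣ ≤ α(Γ): α(Γ_Q) ≤ α(Γ).
-- A partition into k strong cliques yields k disjoint maximal cliques, while an
-- independent set meets each part at most once, so α(Γ) ≤ k ≤ α(Γ_Q). Conversely, if
-- α(Γ_Q) = α(Γ), a maximum family of disjoint maximal cliques covers every vertex v: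
-- otherwise, for a maximal independent I ∋ v, each of them meets I - v, and there would
-- be fewer than α(Γ) of them. This cover is a partition into strong cliques.

module Submission where

open import Defs
open import Data.Nat using (ℕ; suc; _≤_; _<_; z≤n)
open import Data.Nat.Properties using (≤-<-trans; <⇒≱; ≤-antisym; module ≤-Reasoning)
open import Data.Bool using (true; if_then_else_; _≟_)
open import Data.Fin using (Fin; zero; suc)
import Data.Fin as Fin
open import Data.Fin.Properties using (all?; suc-injective)
open import Data.Fin.Subset
open import Data.Fin.Subset.Properties
open import Data.Fin.Subset.Induction using (⊃-wellFounded; Acc; acc)
open import Data.Vec using ([]; _∷_; here; there)
open import Data.Vec.Properties using (lookup∘tabulate; []=⇒lookup; lookup⇒[]=)
open import Data.List as List using (List; []; _∷_; length; map; lookup)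
open import Data.List.Properties using (length-map; length-tabulate)
open import Data.List.Membership.Propositional.Properties using (∈-lookup)
open import Data.List.Relation.Unary.All as All using (All; []; _∷_)
import Data.List.Relation.Unary.All.Properties as All
open import Data.List.Relation.Unary.AllPairs as AllPairs using (AllPairs; []; _∷_)
import Data.List.Relation.Unary.AllPairs.Properties as AllPairs
open import Data.List.Relation.Unary.Any as Any using (Any)
open import Data.List.Relation.Unary.Any.Properties using (lookup-index)
open import Data.List.Relation.Unary.Unique.Propositional using (Unique)
import Data.List.Relation.Unary.Unique.Propositional.Properties as Unique
open import Data.Product using (∃; _×_; _,_; proj₁; proj₂)
open import Function using (_∘_; case_of_)
open import Function.Bundles using (_⇔_; mk⇔)
open import Level using (Level)
open import Relation.Nullary using (Dec; yes; no; contradiction)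
open import Relation.Nullary.Decidable using (isYes; map′; _×-dec_; _→-dec_; ¬?)
open import Relation.Unary using (Pred; Decidable)
open import Relation.Binary using (Symmetric)
open import Relation.Binary.PropositionalEquality using (_≡_; _≢_; refl; sym; trans; cong; subst)

private
  variable
    ℓ : Level
    m n : ℕ
    A : Set

Meets : Subset n → Subset n → Set
Meets C S = ∃ λ v → v ∈ C × v ∈ S

Disjoint : Subset n → Subset n → Set
Disjoint C D = Empty (C ∩ D)

Disjoint-sym : Symmetric (Disjoint {n})
Disjoint-sym {x = C} {D} = subst Empty (∩-comm C D)

⁅⁆-disjoint : {x y : Fin n} → x ≢ y → Disjoint ⁅ x ⁆ ⁅ y ⁆
⁅⁆-disjoint {x = x} {y} x≢y (v , v∈⁅x⁆∩⁅y⁆) =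
  let v∈⁅x⁆ , v∈⁅y⁆ = x∈p∩q⁻ ⁅ x ⁆ ⁅ y ⁆ v∈⁅x⁆∩⁅y⁆
  in x≢y (trans (sym (x∈⁅y⁆⇒x≡y x v∈⁅x⁆)) (x∈⁅y⁆⇒x≡y y v∈⁅y⁆))

meets-─ : ∀ {C D S : Subset n} {x} → x ∈ C → Disjoint C D → Meets D S → Meets D (S - x)
meets-─ x∈C C#D (v , v∈D , v∈S) =
  v , v∈D , x∈p∧x≢y⇒x∈p-y v∈S (λ { refl → C#D (v , x∈p∩q⁺ (x∈C , v∈D)) })

-- Each set of the list gets its own point of S, removed before recursing.
disjoint-meets⇒length≤ : ∀ {S : Subset n} (L : List (Subset n)) →
                         AllPairs Disjoint L → All (λ C → Meets C S) L → length L ≤ ∣ S ∣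
disjoint-meets⇒length≤ [] _ _ = z≤n
disjoint-meets⇒length≤ (C ∷ L) (C#L ∷ disjoint) ((x , x∈C , x∈S) ∷ meets) =
  ≤-<-trans (disjoint-meets⇒length≤ L disjoint meets-S-x) (x∈p⇒∣p-x∣<∣p∣ x∈S)
  where
  meets-S-x = All.zipWith (λ (C#D , D-meets-S) → meets-─ x∈C C#D D-meets-S) (C#L , meets)

enumerate : (p : Subset n) → ∃ λ xs → length xs ≡ ∣ p ∣ × All (_∈ p) xs × Unique xs
enumerate [] = [] , refl , [] , []
enumerate (outside ∷ p) =
  let xs , len , xs⊆p , unique = enumerate p
  in map suc xs , trans (length-map suc xs) len , All.map⁺ (All.map there xs⊆p) ,
     Unique.map⁺ suc-injective unique
enumerate (inside ∷ p) =
  let xs , len , xs⊆p , unique = enumerate p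
  in zero ∷ map suc xs , cong suc (trans (length-map suc xs) len) , here ∷ All.map⁺ (All.map there xs⊆p) ,
     All.map⁺ (All.universal (λ _ ()) xs) ∷ Unique.map⁺ suc-injective unique

Unique⇒AllPairs : ∀ {R : Fin n → Fin n → Set ℓ} {p : Subset n} →
                  (∀ {x y} → x ∈ p → y ∈ p → x ≢ y → R x y) →
                  ∀ {xs} → All (_∈ p) xs → Unique xs → AllPairs R xs
Unique⇒AllPairs R-on-p [] [] = []
Unique⇒AllPairs R-on-p (x∈p ∷ xs⊆p) (x∉xs ∷ unique) =
  All.zipWith (λ (y∈p , x≢y) → R-on-p x∈p y∈p x≢y) (xs⊆p , x∉xs) ∷ Unique⇒AllPairs R-on-p xs⊆p unique

-- The singletons ⁅ f x ⁆ of the points x ∈ p are pairwise disjoint and each meets ⊤.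
injectiveOn⇒∣p∣≤ : (f : Fin n → Fin m) (p : Subset n) →
                   (∀ {x y} → x ∈ p → y ∈ p → x ≢ y → f x ≢ f y) → ∣ p ∣ ≤ m
injectiveOn⇒∣p∣≤ {m = m} f p injective with enumerate p
... | xs , len , xs⊆p , unique = begin
  ∣ p ∣               ≡⟨ sym len ⟩
  length xs           ≡⟨ sym (length-map ⁅f⁆ xs) ⟩
  length (map ⁅f⁆ xs) ≤⟨ disjoint-meets⇒length≤ (map ⁅f⁆ xs) disjoint meets ⟩
  ∣ ⊤ {m} ∣           ≡⟨ ∣⊤∣≡n m ⟩
  m                   ∎
  where
  open ≤-Reasoning
  ⁅f⁆ : Fin _ → Subset m
  ⁅f⁆ = ⁅_⁆ ∘ f
  disjoint : AllPairs Disjoint (map ⁅f⁆ xs)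
  disjoint = AllPairs.map⁺ (Unique⇒AllPairs (λ x∈p y∈p → ⁅⁆-disjoint ∘ injective x∈p y∈p) xs⊆p unique)
  meets : All (λ C → Meets C ⊤) (map ⁅f⁆ xs)
  meets = All.map⁺ (All.universal (λ x → f x , x∈⁅x⁆ (f x) , ∈⊤) xs)

AllPairs-lookup : ∀ {R : A → A → Set ℓ} → Symmetric R → ∀ {xs} → AllPairs R xs →
                  ∀ {i j} → i ≢ j → R (lookup xs i) (lookup xs j)
AllPairs-lookup sym-R (_ ∷ _) {zero} {zero} i≢j = contradiction refl i≢j
AllPairs-lookup sym-R (Rx ∷ _) {zero} {suc j} i≢j = All.lookup Rx (∈-lookup j)
AllPairs-lookup sym-R (Rx ∷ _) {suc i} {zero} i≢j = sym-R (All.lookup Rx (∈-lookup i))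
AllPairs-lookup sym-R (_ ∷ R-xs) {suc i} {suc j} i≢j = AllPairs-lookup sym-R R-xs (i≢j ∘ cong suc)

Maximal : Pred (Subset n) ℓ → Pred (Subset n) ℓ
Maximal P q = P q × (∀ r → P r → q ⊆ r → r ⊆ q)

module _ {P : Pred (Subset n) ℓ} (P? : Decidable P) where

  extend-maximal : ∀ {p} → P p → ∃ λ q → p ⊆ q × Maximal P q
  extend-maximal {p} = go p (⊃-wellFounded p)
    where
    go : ∀ p → Acc _⊃_ p → P p → ∃ λ q → p ⊆ q × Maximal P q
    go p (acc rec) Pp with anySubset? (λ r → p ⊂? r ×-dec P? r)
    ... | yes (r , p⊂r , Pr) =
      let q , r⊆q , maximal = go r (rec p⊂r) Pr in q , ⊆-trans (p⊂q⇒p⊆q p⊂r) r⊆q , maximal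
    ... | no ∄r = p , ⊆-refl , Pp , λ r Pr p⊆r {x} x∈r → case x ∈? p of λ where
        (yes x∈p) → x∈p
        (no x∉p) → contradiction (r , ((λ {y} → p⊆r {y}) , x , x∈r , x∉p) , Pr) ∄r

module _ (G : Graph n) where
  open Graph G

  independent? : Decidable (IsIndependent G)
  independent? I = map′ (λ h {u} {v} → h u v) (λ h u v → h)
    (all? λ u → all? λ v → u ∈? I →-dec v ∈? I →-dec ¬? (u Fin.≟ v) →-dec ¬? (adj u v ≟ true))

  ⁅⁆-independent : ∀ v → IsIndependent G ⁅ v ⁆
  ⁅⁆-independent v x∈⁅v⁆ y∈⁅v⁆ x≢y =
    contradiction (trans (x∈⁅y⁆⇒x≡y v x∈⁅v⁆) (sym (x∈⁅y⁆⇒x≡y v y∈⁅v⁆))) x≢y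

  extend-independent : ∀ {I} → IsIndependent G I → ∃ λ J → I ⊆ J × IsMaximalIndependent G J
  extend-independent = extend-maximal independent?

  ∃-maximalIndependent : ∃ (IsMaximalIndependent G)
  ∃-maximalIndependent =
    let J , _ , maximal = extend-independent {⊥} (λ x∈⊥ → contradiction x∈⊥ ∉⊥) in J , maximal

  strongClique-nonempty : ∀ {C} → IsStrongClique G C → Nonempty C
  strongClique-nonempty (_ , strong) with ∃-maximalIndependent
  ... | I , I-maximal = let v , v∈C , _ = strong I I-maximal in v , v∈C

  -- A vertex v of a larger clique outside C would lie in a maximal independent set missing C.
  strongClique⇒maximalClique : ∀ {C} → IsStrongClique G C → IsMaximalClique G C
  strongClique⇒maximalClique {C} (clique , strong) = clique , λ D D-clique C⊆D {v} v∈D →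
    case v ∈? C of λ where
      (yes v∈C) → v∈C
      (no v∉C) →
        let I , v∈I , I-maximal = extend-independent (⁅⁆-independent v)
            w , w∈C , w∈I = strong I I-maximal
            w≢v = λ w≡v → v∉C (subst (_∈ C) w≡v w∈C)
        in contradiction (D-clique (C⊆D w∈C) v∈D w≢v) (proj₁ I-maximal w∈I (v∈I (x∈⁅x⁆ v)) w≢v)

  ∈-fiber⁻ : ∀ {k} {f : Fin n → Fin k} {i v} → v ∈ fiber G f i → f v ≡ i
  ∈-fiber⁻ {f = f} {i} {v} v∈fiber with f v Fin.≟ i | trans (sym (lookup∘tabulate _ v)) ([]=⇒lookup v∈fiber)
  ... | yes fv≡i | _ = fv≡i
  ... | no _     | ()

  ∈-fiber⁺ : ∀ {k} {f : Fin n → Fin k} {i v} → f v ≡ i → v ∈ fiber G f i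
  ∈-fiber⁺ {f = f} {i} {v} fv≡i = lookup⇒[]= v _ (trans (lookup∘tabulate _ v) (inside-if (f v Fin.≟ i)))
    where
    inside-if : (fv≟i : Dec (f v ≡ i)) → (if isYes fv≟i then inside else outside) ≡ inside
    inside-if (yes _) = refl
    inside-if (no fv≢i) = contradiction fv≡i fv≢i

  cliqueFibers⇒∣I∣≤k : ∀ {k} {f : Fin n → Fin k} → (∀ i → IsClique G (fiber G f i)) →
                       ∀ {I} → IsIndependent G I → ∣ I ∣ ≤ k
  cliqueFibers⇒∣I∣≤k {f = f} cliques {I} I-independent =
    injectiveOn⇒∣p∣≤ f I λ {_} {y} x∈I y∈I x≢y fx≡fy →
      I-independent x∈I y∈I x≢y (cliques (f y) (∈-fiber⁺ fx≡fy) (∈-fiber⁺ refl) x≢y)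

  strongFibers⇒independentQ : ∀ {k} {f : Fin n → Fin k} → (∀ i → IsStrongClique G (fiber G f i)) →
                              IsIndependentQ G (List.tabulate (fiber G f))
  strongFibers⇒independentQ {f = f} strong =
    Unique.tabulate⁺ fiber-injective ,
    All.tabulate⁺ (strongClique⇒maximalClique ∘ strong) ,
    AllPairs.tabulate⁺ fibers-disjoint
    where
    fiber-injective : ∀ {i j} → fiber G f i ≡ fiber G f j → i ≡ j
    fiber-injective {i} eq =
      let v , v∈fiber = strongClique-nonempty (strong i)
      in trans (sym (∈-fiber⁻ v∈fiber)) (∈-fiber⁻ (subst (v ∈_) eq v∈fiber))
    fibers-disjoint : ∀ {i j} → i ≢ j → Disjoint (fiber G f i) (fiber G f j)
    fibers-disjoint i≢j (v , v∈∩) =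
      let v∈i , v∈j = x∈p∩q⁻ _ _ v∈∩ in i≢j (trans (sym (∈-fiber⁻ v∈i)) (∈-fiber⁻ v∈j))

  module _ {L : List (Subset n)} (cover : ∀ v → Any (v ∈_) L) where

    part : Fin n → Fin (length L)
    part v = Any.index (cover v)

    fiber-part : AllPairs Disjoint L → ∀ i → fiber G part i ≡ lookup L i
    fiber-part disjoint i = ⊆-antisym fiber⊆ ⊆fiber
      where
      fiber⊆ : fiber G part i ⊆ lookup L i
      fiber⊆ {v} v∈fiber = subst (λ j → v ∈ lookup L j) (∈-fiber⁻ v∈fiber) (lookup-index (cover v))
      ⊆fiber : lookup L i ⊆ fiber G part i
      ⊆fiber {v} v∈Lᵢ = case part v Fin.≟ i of λ where
        (yes partv≡i) → ∈-fiber⁺ partv≡i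
        (no partv≢i) → contradiction (v , x∈p∩q⁺ (lookup-index (cover v) , v∈Lᵢ))
                                     (AllPairs-lookup Disjoint-sym disjoint partv≢i)

  localizable⇒α≤α-Q : ∀ {a b} → IsIndependenceNumber G a → IsIndependenceNumberQ G b →
                      IsLocalizable G → a ≤ b
  localizable⇒α≤α-Q {a} {b} ((I , I-independent , ∣I∣≡a) , _) (_ , maximumQ) (k , f , strong) = begin
    a                                  ≡⟨ sym ∣I∣≡a ⟩
    ∣ I ∣                              ≤⟨ cliqueFibers⇒∣I∣≤k (proj₁ ∘ strong) I-independent ⟩
    k                                  ≡⟨ sym (length-tabulate (fiber G f)) ⟩
    length (List.tabulate (fiber G f)) ≤⟨ maximumQ _ (strongFibers⇒independentQ strong) ⟩
    b                                  ∎
    where open ≤-Reasoning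

  module _ (cis : IsCIS G) where

    independentQ⇒length≤∣I∣ : ∀ {I L} → IsMaximalIndependent G I → IsIndependentQ G L → length L ≤ ∣ I ∣
    independentQ⇒length≤∣I∣ {I} {L} I-maximal (_ , maximal , disjoint) =
      disjoint-meets⇒length≤ L disjoint (All.map (λ {C} C-maximal → proj₂ (cis C C-maximal) I I-maximal) maximal)

    uncovered⇒length< : ∀ {L v} → IsIndependentQ G L → All (v ∉_) L →
                        ∃ λ I → IsIndependent G I × length L < ∣ I ∣
    uncovered⇒length< {L} {v} (_ , maximal , disjoint) v∉L with extend-independent (⁅⁆-independent v)
    ... | I , v∈I , I-maximal =
      I , proj₁ I-maximal , ≤-<-trans (disjoint-meets⇒length≤ L disjoint meets) (x∈p⇒∣p-x∣<∣p∣ (v∈I (x∈⁅x⁆ v)))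
      where
      meets-I-v : ∀ {C} → IsMaximalClique G C × v ∉ C → Meets C (I - v)
      meets-I-v {C} (C-maximal , v∉C) =
        let w , w∈C , w∈I = proj₂ (cis C C-maximal) I I-maximal
        in w , w∈C , x∈p∧x≢y⇒x∈p-y w∈I (λ w≡v → v∉C (subst (_∈ C) w≡v w∈C))
      meets = All.zipWith meets-I-v (maximal , v∉L)

    α-Q≤α : ∀ {a b} → IsIndependenceNumber G a → IsIndependenceNumberQ G b → b ≤ a
    α-Q≤α {a} {b} (_ , maximum) ((L , L-independentQ , length≡b) , _) with ∃-maximalIndependent
    ... | I , I-maximal = begin
      b        ≡⟨ sym length≡b ⟩
      length L ≤⟨ independentQ⇒length≤∣I∣ I-maximal L-independentQ ⟩
      ∣ I ∣    ≤⟨ maximum I (proj₁ I-maximal) ⟩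
      a        ∎
      where open ≤-Reasoning

    α-Q≡α⇒localizable : ∀ {a b} → IsIndependenceNumber G a → IsIndependenceNumberQ G b →
                        b ≡ a → IsLocalizable G
    α-Q≡α⇒localizable {a} {b} (_ , maximum) ((L , L-independentQ@(_ , maximal , disjoint) , length≡b) , _) b≡a =
      length L , part cover ,
      λ i → subst (IsStrongClique G) (sym (fiber-part cover disjoint i)) (cis _ (All.lookup maximal (∈-lookup i)))
      where
      open ≤-Reasoning
      cover : ∀ v → Any (v ∈_) L
      cover v = case Any.any? (v ∈?_) L of λ where
        (yes v∈L) → v∈L
        (no v∉L) →
          let I , I-independent , length<∣I∣ = uncovered⇒length< L-independentQ (All.¬Any⇒All¬ L v∉L)
          in contradiction (begin
               ∣ I ∣    ≤⟨ maximum I I-independent ⟩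
               a        ≡⟨ sym b≡a ⟩
               b        ≡⟨ sym length≡b ⟩
               length L ∎) (<⇒≱ length<∣I∣)

lemma4p2 : ∀ {n : ℕ} (G : Graph n) → IsVertexTransitive G → IsCIS G
           → ∀ (a b : ℕ) → IsIndependenceNumber G a → IsIndependenceNumberQ G b
           → (IsLocalizable G ⇔ b ≡ a)
lemma4p2 G _ cis a b α α-Q =
  mk⇔ (λ localizable → ≤-antisym (α-Q≤α G cis α α-Q) (localizable⇒α≤α-Q G α α-Q localizable))
      (α-Q≡α⇒localizable G cis α α-Q)
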